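{- If $(t_k)$ and $(\tau_k)$, $k=0,1,2,\ldots$, are a binomial-transform pair of the first kind, then so are the sequences \[ a_k=-\sum_{j=1}^k\tau_{j-1}\quad\text{and}\quad \alpha_k=(1-\delta_{k0})\,t_{k-1+\delta_{k0}},\qquad k=0,1,2,\ldots. \]
   Context: Two sequences $(t_k)_{k\ge0}$ and $(\tau_k)_{k\ge0}$ of complex numbers form a binomial-transform pair of the first kind if $\tau_n=\sum_{k=0}^n(-1)^k\binom nk t_k$ for every non-negative integer $n$. $\delta_{ij}$ is the Kronecker delta (equal to $1$ if $i=j$ and $0$ otherwise); an empty sum equals $0$. -}

module Defs where

open import Level using (Level)
open import Data.Nat using (ℕ; zero; suc; _∸_) renaming (_+_ to _+ℕ_)
open import Data.Nat.Combinatorics using (_C_)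
open import Algebra.Bundles using (CommutativeRing)

δ : ℕ → ℕ → ℕ
δ zero    zero    = 1
δ zero    (suc _) = 0
δ (suc _) zero    = 0
δ (suc i) (suc j) = δ i j

module _ {c ℓ : Level} (R : CommutativeRing c ℓ) where
  open CommutativeRing R

  natR : ℕ → Carrier
  natR zero    = 0#
  natR (suc n) = 1# + natR n

  sgn : ℕ → Carrier
  sgn zero    = 1#
  sgn (suc k) = - sgn k

  Σ< : ℕ → (ℕ → Carrier) → Carrier
  Σ< zero    f = 0#
  Σ< (suc n) f = Σ< n f + f n

  Σ1to : ℕ → (ℕ → Carrier) → Carrier
  Σ1to k f = Σ< k (λ i → f (suc i))

  -- binomial-transform pair of the first kind:
  -- τ n = Σ_{k=0}^{n} (-1)^k (n choose k) t k, for all n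
  IsBinomialPair : (ℕ → Carrier) → (ℕ → Carrier) → Set ℓ
  IsBinomialPair t τ =
    ∀ n → τ n ≈ Σ< (suc n) (λ k → sgn k * natR (n C k) * t k)

  aSeq : (ℕ → Carrier) → ℕ → Carrier
  aSeq τ k = - Σ1to k (λ j → τ (j ∸ 1))

  αSeq : (ℕ → Carrier) → ℕ → Carrier
  αSeq t k = (1# - natR (δ k 0)) * t ((k ∸ 1) +ℕ δ k 0)

{-# OPTIONS --safe #-}
-- Write B f n = Σ_{k ≤ n} (-1)^k C(n,k) f k.  Pascal's rule gives
-- B f (n+1) = B f n - B (f ∘ suc) n, hence B g (n+1) = B h n whenever
-- g (k+1) = g k - h k for all k.  With g = B f and h = B (f ∘ suc) this shows,
-- by induction on n, that B is an involution.  With g = a and h = τ it gives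
-- B a (m+1) = B τ m = B (B t) m = t m = α (m+1), while B a 0 = a 0 = 0 = α 0.
module Submission where

open import Defs
open import Level using (Level)
open import Data.Nat using (ℕ; zero; suc) renaming (_+_ to _+ℕ_)
import Data.Nat.Properties as ℕ
open import Data.Nat.Combinatorics using (_C_; nCk+nC[k+1]≡[n+1]C[k+1])
open import Data.Nat.Combinatorics.Specification using (k>n⇒nCk≡0)
open import Function using (_∘_)
open import Relation.Binary.PropositionalEquality as ≡ using (cong)
open import Algebra.Bundles using (CommutativeRing)
import Algebra.Properties.Ring as RingProperties
import Algebra.Properties.AbelianGroup as AbelianGroupProperties
import Algebra.Properties.CommutativeSemigroup as CommutativeSemigroupProperties
import Relation.Binary.Reasoning.Setoid as SetoidReasoning

module _ {c ℓ : Level} (R : CommutativeRing c ℓ) where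
  open CommutativeRing R
  open RingProperties ring using (-‿+-comm; -‿distribˡ-*; x[y-z]≈xy-xz; -0#≈0#)
  open AbelianGroupProperties +-abelianGroup using (⁻¹-anti-homo‿-; xyx⁻¹≈y)
  open CommutativeSemigroupProperties +-commutativeSemigroup using (interchange)
  open SetoidReasoning setoid

  x-[x-y]≈y : ∀ x y → x - (x - y) ≈ y
  x-[x-y]≈y x y = begin
    x - (x - y)  ≈⟨ +-congˡ (⁻¹-anti-homo‿- x y) ⟩
    x + (y - x)  ≈⟨ +-assoc x y (- x) ⟨
    x + y - x    ≈⟨ xyx⁻¹≈y x y ⟩
    y            ∎

  natR-homo-+ : ∀ m n → natR R (m +ℕ n) ≈ natR R m + natR R n
  natR-homo-+ zero    n = sym (+-identityˡ _)
  natR-homo-+ (suc m) n = trans (+-congˡ (natR-homo-+ m n)) (sym (+-assoc _ _ _))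

  Σ<-cong : ∀ n {f g : ℕ → Carrier} → (∀ k → f k ≈ g k) → Σ< R n f ≈ Σ< R n g
  Σ<-cong zero    f≈g = refl
  Σ<-cong (suc n) f≈g = +-cong (Σ<-cong n f≈g) (f≈g n)

  Σ<-homo-- : ∀ n (f g : ℕ → Carrier) →
              Σ< R n (λ k → f k - g k) ≈ Σ< R n f - Σ< R n g
  Σ<-homo-- zero    f g = sym (-‿inverseʳ 0#)
  Σ<-homo-- (suc n) f g = begin
    Σ< R n (λ k → f k - g k) + (f n - g n)  ≈⟨ +-congʳ (Σ<-homo-- n f g) ⟩
    (Σ< R n f - Σ< R n g) + (f n - g n)     ≈⟨ interchange _ _ _ _ ⟩
    (Σ< R n f + f n) + (- Σ< R n g - g n)   ≈⟨ +-congˡ (-‿+-comm _ _) ⟩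
    (Σ< R n f + f n) - (Σ< R n g + g n)     ∎

  Σ<-head : ∀ n (f : ℕ → Carrier) → Σ< R (suc n) f ≈ f 0 + Σ< R n (f ∘ suc)
  Σ<-head zero    f = trans (+-identityˡ _) (sym (+-identityʳ _))
  Σ<-head (suc n) f = trans (+-congʳ (Σ<-head n f)) (+-assoc _ _ _)

  binomialSummand : (ℕ → Carrier) → ℕ → ℕ → Carrier
  binomialSummand f n k = sgn R k * natR R (n C k) * f k

  -- IsBinomialPair R t τ unfolds to ∀ n → τ n ≈ binomial t n.
  binomial : (ℕ → Carrier) → ℕ → Carrier
  binomial f n = Σ< R (suc n) (binomialSummand f n)

  binomialSummand-pascal : ∀ f n k →
    binomialSummand f (suc n) (suc k) ≈
    binomialSummand f n (suc k) - binomialSummand (f ∘ suc) n k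
  binomialSummand-pascal f n k = begin
    - s * natR R (suc n C suc k) * x  ≈⟨ *-congʳ (*-congˡ pascal) ⟩
    - s * (p + q) * x                 ≈⟨ *-congʳ (distribˡ (- s) p q) ⟩
    (- s * p + - s * q) * x           ≈⟨ distribʳ x (- s * p) (- s * q) ⟩
    - s * p * x + - s * q * x         ≈⟨ +-comm _ _ ⟩
    - s * q * x + - s * p * x         ≈⟨ +-congˡ (neg-*-* p) ⟩
    - s * q * x - s * p * x           ∎
    where
    s = sgn R k
    p = natR R (n C k)
    q = natR R (n C suc k)
    x = f (suc k)
    pascal : natR R (suc n C suc k) ≈ p + q
    pascal = trans (reflexive (cong (natR R) (≡.sym (nCk+nC[k+1]≡[n+1]C[k+1] n k))))
                   (natR-homo-+ (n C k) (n C suc k))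
    neg-*-* : ∀ y → - s * y * x ≈ - (s * y * x)
    neg-*-* y = trans (*-congʳ (sym (-‿distribˡ-* s y))) (sym (-‿distribˡ-* (s * y) x))

  binomialSummand-beyond : ∀ f n → binomialSummand f n (suc n) ≈ 0#
  binomialSummand-beyond f n = begin
    sgn R (suc n) * natR R (n C suc n) * f (suc n)  ≈⟨ *-congʳ (*-congˡ nC[n+1]≈0) ⟩
    sgn R (suc n) * 0# * f (suc n)                  ≈⟨ *-congʳ (zeroʳ _) ⟩
    0# * f (suc n)                                  ≈⟨ zeroˡ _ ⟩
    0#                                              ∎
    where
    nC[n+1]≈0 : natR R (n C suc n) ≈ 0#
    nC[n+1]≈0 = reflexive (cong (natR R) (k>n⇒nCk≡0 (ℕ.n<1+n n)))

  binomial-zero : ∀ f → binomial f 0 ≈ f 0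
  binomial-zero f = begin
    0# + 1# * (1# + 0#) * f 0  ≈⟨ +-identityˡ _ ⟩
    1# * (1# + 0#) * f 0       ≈⟨ *-congʳ (trans (*-identityˡ _) (+-identityʳ 1#)) ⟩
    1# * f 0                   ≈⟨ *-identityˡ _ ⟩
    f 0                        ∎

  binomial-cong : ∀ {f g} → (∀ k → f k ≈ g k) → ∀ n → binomial f n ≈ binomial g n
  binomial-cong f≈g n = Σ<-cong (suc n) (λ k → *-congˡ (f≈g k))

  binomial-homo-- : ∀ f g n → binomial (λ k → f k - g k) n ≈ binomial f n - binomial g n
  binomial-homo-- f g n =
    trans (Σ<-cong (suc n) (λ k → x[y-z]≈xy-xz _ (f k) (g k))) (Σ<-homo-- (suc n) _ _)

  binomial-suc : ∀ f n → binomial f (suc n) ≈ binomial f n - binomial (f ∘ suc) n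
  binomial-suc f n = begin
    binomial f (suc n)
      ≈⟨ Σ<-head (suc n) _ ⟩
    b₀ + Σ< R (suc n) (binomialSummand f (suc n) ∘ suc)
      ≈⟨ +-congˡ (Σ<-cong (suc n) (binomialSummand-pascal f n)) ⟩
    b₀ + Σ< R (suc n) (λ k → binomialSummand f n (suc k) - binomialSummand (f ∘ suc) n k)
      ≈⟨ +-congˡ (Σ<-homo-- (suc n) _ _) ⟩
    b₀ + (Σ< R (suc n) (binomialSummand f n ∘ suc) - binomial (f ∘ suc) n)
      ≈⟨ +-assoc _ _ _ ⟨
    (b₀ + Σ< R (suc n) (binomialSummand f n ∘ suc)) - binomial (f ∘ suc) n
      ≈⟨ +-congʳ (Σ<-head (suc n) _) ⟨
    (binomial f n + binomialSummand f n (suc n)) - binomial (f ∘ suc) n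
      ≈⟨ +-congʳ (trans (+-congˡ (binomialSummand-beyond f n)) (+-identityʳ _)) ⟩
    binomial f n - binomial (f ∘ suc) n
      ∎
    where b₀ = binomialSummand f n 0

  binomial-suc-of-difference : ∀ {g h} → (∀ k → g (suc k) ≈ g k - h k) →
                               ∀ n → binomial g (suc n) ≈ binomial h n
  binomial-suc-of-difference {g} {h} Δg≈-h n = begin
    binomial g (suc n)                                ≈⟨ binomial-suc g n ⟩
    binomial g n - binomial (g ∘ suc) n               ≈⟨ +-congˡ (-‿cong (binomial-cong Δg≈-h n)) ⟩
    binomial g n - binomial (λ k → g k - h k) n       ≈⟨ +-congˡ (-‿cong (binomial-homo-- g h n)) ⟩
    binomial g n - (binomial g n - binomial h n)      ≈⟨ x-[x-y]≈y _ _ ⟩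
    binomial h n                                      ∎

  binomial-involutive : ∀ f n → binomial (binomial f) n ≈ f n
  binomial-involutive f zero    = trans (binomial-zero (binomial f)) (binomial-zero f)
  binomial-involutive f (suc n) = begin
    binomial (binomial f) (suc n)    ≈⟨ binomial-suc-of-difference (binomial-suc f) n ⟩
    binomial (binomial (f ∘ suc)) n  ≈⟨ binomial-involutive (f ∘ suc) n ⟩
    f (suc n)                        ∎

  aSeq-zero : ∀ τ → aSeq R τ 0 ≈ 0#
  aSeq-zero τ = -0#≈0#

  aSeq-suc : ∀ τ k → aSeq R τ (suc k) ≈ aSeq R τ k - τ k
  aSeq-suc τ k = sym (-‿+-comm _ _)

  αSeq-zero : ∀ t → αSeq R t 0 ≈ 0#
  αSeq-zero t = trans (*-congʳ (trans (+-congˡ (-‿cong (+-identityʳ 1#))) (-‿inverseʳ 1#))) (zeroˡ _)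

  αSeq-suc : ∀ t m → αSeq R t (suc m) ≈ t m
  αSeq-suc t m = begin
    (1# - 0#) * t (m +ℕ 0)  ≈⟨ *-congʳ (trans (+-congˡ -0#≈0#) (+-identityʳ 1#)) ⟩
    1# * t (m +ℕ 0)         ≈⟨ *-identityˡ _ ⟩
    t (m +ℕ 0)              ≡⟨ cong t (ℕ.+-identityʳ m) ⟩
    t m                     ∎

theorem14 : {c ℓ : Level} (R : CommutativeRing c ℓ) →
    (t τ : ℕ → CommutativeRing.Carrier R) →
    IsBinomialPair R t τ →
    IsBinomialPair R (aSeq R τ) (αSeq R t)
theorem14 R t τ τ≈Bt = α≈Ba
  where
  open CommutativeRing R
  open SetoidReasoning setoid

  α≈Ba : IsBinomialPair R (aSeq R τ) (αSeq R t)
  α≈Ba zero = begin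
    αSeq R t 0               ≈⟨ αSeq-zero R t ⟩
    0#                       ≈⟨ aSeq-zero R τ ⟨
    aSeq R τ 0               ≈⟨ binomial-zero R (aSeq R τ) ⟨
    binomial R (aSeq R τ) 0  ∎
  α≈Ba (suc m) = begin
    αSeq R t (suc m)               ≈⟨ αSeq-suc R t m ⟩
    t m                            ≈⟨ binomial-involutive R t m ⟨
    binomial R (binomial R t) m    ≈⟨ binomial-cong R τ≈Bt m ⟨
    binomial R τ m                 ≈⟨ binomial-suc-of-difference R (aSeq-suc R τ) m ⟨
    binomial R (aSeq R τ) (suc m)  ∎
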